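{- Let $m\ge 3$ and $n\ge 5$ be integers, let $\Gamma=C_m\Box C_n$ with vertex set $\{0,\dots,m-1\}\times\{0,\dots,n-1\}$, and let $S$ be a disjunctive dominating set of $\Gamma$. For $j\in\mathbb Z$ let $x_j=|S\cap T_j|$, where $T_j=\{(i,j')\in V(\Gamma): j'\equiv j \pmod n\}$. Then for every $j=0,1,\dots,n-1$, $$x_{j-2}+4x_{j-1}+8x_j+4x_{j+1}+x_{j+2}\ge 2m.$$
   Context: $C_k$ is the cycle with vertex set $\{0,\dots,k-1\}$, where $i,j$ are adjacent iff $i-j\equiv\pm1\pmod k$. The Cartesian product $G\Box H$ has vertex set $V(G)\times V(H)$, with $(g,h)$ adjacent to $(g',h')$ iff either $g=g'$ and $hh'\in E(H)$, or $h=h'$ and $gg'\in E(G)$. For a graph $\Gamma$ and vertex $v$, $\Gamma(v)$ and $\Gamma_2(v)$ are the sets of vertices at distance exactly $1$ and exactly $2$ from $v$. A set $S\subseteq V(\Gamma)$ is a disjunctive dominating set if every $v\notin S$ satisfies $|\Gamma(v)\cap S|\ge 1$ or $|\Gamma_2(v)\cap S|\ge 2$. -}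

module Defs where

open import Data.Nat as ℕ using (ℕ; zero; suc; _+_; _%_; NonZero)
open import Data.Fin using (Fin; toℕ)
open import Data.Fin.Base using ()
open import Data.List using (List; allFin; length; filter; cartesianProduct)
open import Data.Product using (_×_; _,_; Σ; ∃; ∃-syntax; proj₁; proj₂)
open import Data.Sum using (_⊎_)
open import Data.Bool using (Bool; true; T)
open import Data.Integer as ℤ using (ℤ; _%ℕ_)
open import Relation.Binary.PropositionalEquality using (_≡_; _≢_)
open import Relation.Nullary using (¬_)
open import Relation.Nullary.Decidable using (_×-dec_)
open import Data.Bool.Properties using (T?)

CycleAdj : (k : ℕ) → Fin k → Fin k → Set
CycleAdj k i j = ((toℕ i + 1) % suc (ℕ.pred k) ≡ toℕ j) ⊎ ((toℕ j + 1) % suc (ℕ.pred k) ≡ toℕ i)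

V : ℕ → ℕ → Set
V m n = Fin m × Fin n

Adj : (m n : ℕ) → V m n → V m n → Set
Adj m n (g , h) (g' , h') = (g ≡ g' × CycleAdj n h h') ⊎ (h ≡ h' × CycleAdj m g g')

Dist1 : (m n : ℕ) → V m n → V m n → Set
Dist1 = Adj

Dist2 : (m n : ℕ) → V m n → V m n → Set
Dist2 m n u v = u ≢ v × ¬ Adj m n u v × (∃[ w ] (Adj m n u w × Adj m n w v))

IsDisjunctiveDominating : (m n : ℕ) → (V m n → Bool) → Set
IsDisjunctiveDominating m n S =
  ∀ v → ¬ T (S v) →
    (∃[ u ] (T (S u) × Dist1 m n v u))
    ⊎ (∃[ u ] ∃[ w ] (u ≢ w × T (S u) × T (S w) × Dist2 m n v u × Dist2 m n v w))

vertices : (m n : ℕ) → List (V m n)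
vertices m n = cartesianProduct (allFin m) (allFin n)

x : (m n : ℕ) .{{_ : NonZero n}} → (V m n → Bool) → ℤ → ℕ
x m n S j = length (filter (λ v → T? (S v) ×-dec (toℕ (proj₂ v) ℕ.≟ (j %ℕ n))) (vertices m n))

{-# OPTIONS --safe #-}
-- Every vertex v satisfies 2 ≤ 2[v ∈ S] + 2|Γ(v) ∩ S| + |Γ₂(v) ∩ S|: either v ∈ S, or v has a
-- neighbour in S, or two distinct vertices of S lie at distance 2 from v.  Γ₂(v) lies among the
-- eight positions reached from v by two torus steps, so the bound still holds when |Γ₂(v) ∩ S| is
-- replaced by the count of S over these positions.  Summing over the m vertices of the row T_j,
-- each stencil position runs through a whole row T_{j+c}, which contributes its x_{j+c} with
-- weight 1, 4, 8, 4, 1 for c = -2, …, 2.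
module Submission where

open import Data.Nat as ℕ using (ℕ; zero; suc; _+_; _*_; _∸_; _≤_; _<_; NonZero; _%_; z≤n; z<s; s<s)
open import Data.Nat.Properties
open import Data.Nat.DivMod
open import Data.Nat.Tactic.RingSolver using (solve-∀)
open import Data.Fin as Fin using (Fin; toℕ; fromℕ<; punchIn; punchOut)
open import Data.Fin.Patterns using (0F; 1F; 2F; 3F; 4F; 5F; 6F; 7F)
open import Data.Fin.Properties using (toℕ-injective; toℕ<n; toℕ-fromℕ<; punchInᵢ≢i; punchIn-punchOut)
open import Data.Fin.Permutation as Perm using (Permutation′; permutation; _⟨$⟩ʳ_; flip; _∘ₚ_)
open import Data.Vec.Functional using (Vector; _∷_; []; removeAt)
open import Algebra.Properties.Semiring.Sum +-*-semiring
  using (sum; sum-syntax; sum-remove; sum-cong-≗; sum-replicate-zero; ∑-distrib-+; ∑-comm; *-distribˡ-sum; sum-permute)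
open import Data.Bool using (Bool; true; false; T; _∧_; if_then_else_)
open import Data.Bool.Properties using (T?; ∧-identityʳ; ∧-zeroʳ)
open import Data.List using (List; _++_; length; filter; map; tabulate; cartesianProduct; allFin)
open import Data.List.Properties using (filter-++; length-++; map-tabulate)
open import Data.Integer as ℤ using (-[1+_]; +_; _%ℕ_)
open import Data.Product using (_×_; _,_; proj₁; proj₂; ∃-syntax)
open import Data.Sum using (_⊎_; inj₁; inj₂; [_,_]′)
open import Data.Empty using (⊥-elim)
open import Function using (_∘_; id)
open import Relation.Nullary using (does; yes; no; _×-dec_)
open import Relation.Nullary.Decidable using (dec-true; dec-false)
open import Relation.Unary using (Pred; Decidable)
open import Relation.Binary.PropositionalEquality

open import Defs

[m%n+o]%n≡[m+o]%n : ∀ m o n .{{_ : NonZero n}} → (m % n + o) % n ≡ (m + o) % n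
[m%n+o]%n≡[m+o]%n m o n = begin
  (m % n + o) % n          ≡⟨ %-distribˡ-+ (m % n) o n ⟩
  (m % n % n + o % n) % n  ≡⟨ cong (λ r → (r + o % n) % n) (m%n%n≡m%n m n) ⟩
  (m % n + o % n) % n      ≡⟨ %-distribˡ-+ m o n ⟨
  (m + o) % n              ∎
  where open ≡-Reasoning

-[1+d]%ℕn≡n∸[1+d] : ∀ {d n} .{{_ : NonZero n}} → d < n → -[1+ d ] %ℕ n ≡ n ∸ suc d
-[1+d]%ℕn≡n∸[1+d] {d} {n} d<n with m≤n⇒m<n∨m≡n d<n
... | inj₁ 1+d<n rewrite m<n⇒m%n≡m 1+d<n = refl
... | inj₂ refl rewrite n%n≡0 (suc d) ⦃ _ ⦄ = sym (n∸n≡0 d)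

[i+k]%[1+k]≡[i-1]%ℕ[1+k] : ∀ k (i : Fin (suc k)) → (toℕ i + k) % suc k ≡ (+ toℕ i ℤ.- + 1) %ℕ suc k
[i+k]%[1+k]≡[i-1]%ℕ[1+k] k Fin.zero = begin
  k % suc k          ≡⟨ m≤n⇒m%n≡m ≤-refl ⟩
  k                  ≡⟨ -[1+d]%ℕn≡n∸[1+d] z<s ⟨
  -[1+ 0 ] %ℕ suc k  ∎
  where open ≡-Reasoning
[i+k]%[1+k]≡[i-1]%ℕ[1+k] k (Fin.suc i) = begin
  (suc (toℕ i) + k) % suc k  ≡⟨ cong (_% suc k) (+-suc (toℕ i) k) ⟨
  (toℕ i + suc k) % suc k    ≡⟨ [m+n]%n≡m%n (toℕ i) (suc k) ⟩
  toℕ i % suc k              ∎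
  where open ≡-Reasoning

[i+2k]%[1+k]≡[i-2]%ℕ[1+k] : ∀ k (i : Fin (suc k)) → (toℕ i + (k + k)) % suc k ≡ (+ toℕ i ℤ.- + 2) %ℕ suc k
[i+2k]%[1+k]≡[i-2]%ℕ[1+k] zero Fin.zero = refl
[i+2k]%[1+k]≡[i-2]%ℕ[1+k] (suc k) Fin.zero = begin
  (suc k + suc k) % suc (suc k)        ≡⟨ cong (_% suc (suc k)) (arith k) ⟩
  (k + 1 * suc (suc k)) % suc (suc k)  ≡⟨ [m+kn]%n≡m%n k 1 (suc (suc k)) ⟩
  k % suc (suc k)                      ≡⟨ m<n⇒m%n≡m (m<n+m k z<s) ⟩
  k                                    ≡⟨ -[1+d]%ℕn≡n∸[1+d] (s<s z<s) ⟨
  -[1+ 1 ] %ℕ suc (suc k)              ∎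
  where
  open ≡-Reasoning
  arith : ∀ k → suc k + suc k ≡ k + 1 * suc (suc k)
  arith = solve-∀
[i+2k]%[1+k]≡[i-2]%ℕ[1+k] k (Fin.suc Fin.zero) = begin
  suc (k + k) % suc k   ≡⟨ cong (_% suc k) (+-suc k k) ⟨
  (k + suc k) % suc k   ≡⟨ [m+n]%n≡m%n k (suc k) ⟩
  k % suc k             ≡⟨ m≤n⇒m%n≡m ≤-refl ⟩
  k                     ≡⟨ -[1+d]%ℕn≡n∸[1+d] z<s ⟨
  -[1+ 0 ] %ℕ suc k     ∎
  where open ≡-Reasoning
[i+2k]%[1+k]≡[i-2]%ℕ[1+k] k (Fin.suc (Fin.suc i)) = begin
  (2 + toℕ i + (k + k)) % suc k    ≡⟨ cong (_% suc k) (arith (toℕ i) k) ⟩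
  (toℕ i + 2 * suc k) % suc k      ≡⟨ [m+kn]%n≡m%n (toℕ i) 2 (suc k) ⟩
  toℕ i % suc k                    ∎
  where
  open ≡-Reasoning
  arith : ∀ i k → 2 + i + (k + k) ≡ i + 2 * suc k
  arith = solve-∀

module Rotation (k : ℕ) where

  shift : ℕ → Fin (suc k) → Fin (suc k)
  shift a i = (toℕ i + a) mod suc k

  toℕ-shift : ∀ a i → toℕ (shift a i) ≡ (toℕ i + a) % suc k
  toℕ-shift a i = toℕ-fromℕ< _

  shift-shift : ∀ a b i → shift a (shift b i) ≡ shift (b + a) i
  shift-shift a b i = toℕ-injective (begin
    toℕ (shift a (shift b i))      ≡⟨ toℕ-shift a (shift b i) ⟩
    (toℕ (shift b i) + a) % suc k  ≡⟨ cong (λ r → (r + a) % suc k) (toℕ-shift b i) ⟩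
    ((toℕ i + b) % suc k + a) % suc k ≡⟨ [m%n+o]%n≡[m+o]%n (toℕ i + b) a (suc k) ⟩
    (toℕ i + b + a) % suc k        ≡⟨ cong (_% suc k) (+-assoc (toℕ i) b a) ⟩
    (toℕ i + (b + a)) % suc k      ≡⟨ toℕ-shift (b + a) i ⟨
    toℕ (shift (b + a) i)          ∎)
    where open ≡-Reasoning

  shift-period : ∀ i → shift (suc k) i ≡ i
  shift-period i = toℕ-injective (begin
    toℕ (shift (suc k) i)      ≡⟨ toℕ-shift (suc k) i ⟩
    (toℕ i + suc k) % suc k    ≡⟨ [m+n]%n≡m%n (toℕ i) (suc k) ⟩
    toℕ i % suc k              ≡⟨ m<n⇒m%n≡m (toℕ<n i) ⟩
    toℕ i                      ∎)
    where open ≡-Reasoning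

  next prev : Fin (suc k) → Fin (suc k)
  next = shift 1
  prev = shift k

  prev-next : ∀ i → prev (next i) ≡ i
  prev-next i = trans (shift-shift k 1 i) (shift-period i)

  next-prev : ∀ i → next (prev i) ≡ i
  next-prev i = trans (shift-shift 1 k i) (trans (cong (λ a → shift a i) (+-comm k 1)) (shift-period i))

  rotation : Permutation′ (suc k)
  rotation = permutation next prev next-prev prev-next

  cycleAdj⇒next⊎prev : ∀ {i j} → CycleAdj (suc k) i j → j ≡ next i ⊎ j ≡ prev i
  cycleAdj⇒next⊎prev {i} (inj₁ i+1≡j) = inj₁ (toℕ-injective (trans (sym i+1≡j) (sym (toℕ-shift 1 i))))
  cycleAdj⇒next⊎prev {i} {j} (inj₂ j+1≡i) = inj₂ (begin
    j               ≡⟨ prev-next j ⟨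
    prev (next j)   ≡⟨ cong prev (toℕ-injective (trans (toℕ-shift 1 j) j+1≡i)) ⟩
    prev i          ∎)
    where open ≡-Reasoning

  toℕ≡i%ℕ : ∀ i → toℕ i ≡ (+ toℕ i) %ℕ suc k
  toℕ≡i%ℕ i = sym (m<n⇒m%n≡m (toℕ<n i))

  toℕ-next≡[i+1]%ℕ : ∀ i → toℕ (next i) ≡ (+ toℕ i ℤ.+ + 1) %ℕ suc k
  toℕ-next≡[i+1]%ℕ = toℕ-shift 1

  toℕ-next²≡[i+2]%ℕ : ∀ i → toℕ (next (next i)) ≡ (+ toℕ i ℤ.+ + 2) %ℕ suc k
  toℕ-next²≡[i+2]%ℕ i = trans (cong toℕ (shift-shift 1 1 i)) (toℕ-shift 2 i)

  toℕ-prev≡[i-1]%ℕ : ∀ i → toℕ (prev i) ≡ (+ toℕ i ℤ.- + 1) %ℕ suc k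
  toℕ-prev≡[i-1]%ℕ i = trans (toℕ-shift k i) ([i+k]%[1+k]≡[i-1]%ℕ[1+k] k i)

  toℕ-prev²≡[i-2]%ℕ : ∀ i → toℕ (prev (prev i)) ≡ (+ toℕ i ℤ.- + 2) %ℕ suc k
  toℕ-prev²≡[i-2]%ℕ i =
    trans (cong toℕ (shift-shift k k i)) (trans (toℕ-shift (k + k) i) ([i+2k]%[1+k]≡[i-2]%ℕ[1+k] k i))

indicator : Bool → ℕ
indicator b = if b then 1 else 0

T⇒indicator≡1 : ∀ {b} → T b → indicator b ≡ 1
T⇒indicator≡1 {true} _ = refl

sum-mono-≤ : ∀ {n} {f g : Fin n → ℕ} → (∀ i → f i ≤ g i) → sum f ≤ sum g
sum-mono-≤ {zero}  _   = z≤n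
sum-mono-≤ {suc n} f≤g = +-mono-≤ (f≤g Fin.zero) (sum-mono-≤ (f≤g ∘ Fin.suc))

sum-const : ∀ n c → ∑[ i < n ] c ≡ n * c
sum-const zero    c = refl
sum-const (suc n) c = cong (_+_ c) (sum-const n c)

t[i]≤sum : ∀ {n} (t : Fin n → ℕ) i → t i ≤ sum t
t[i]≤sum {suc n} t i = subst (t i ≤_) (sym (sum-remove t)) (m≤m+n (t i) _)

t[i]+t[j]≤sum : ∀ {n} (t : Fin n → ℕ) {i j} → i ≢ j → t i + t j ≤ sum t
t[i]+t[j]≤sum {suc n} t {i} {j} i≢j = begin
  t i + t j                                ≡⟨ cong (λ l → t i + t l) (punchIn-punchOut i≢j) ⟨
  t i + removeAt t i (punchOut i≢j)        ≤⟨ +-monoʳ-≤ (t i) (t[i]≤sum (removeAt t i) (punchOut i≢j)) ⟩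
  t i + sum (removeAt t i)                 ≡⟨ sum-remove t ⟨
  sum t                                    ∎
  where open ≤-Reasoning

sum-supported-at : ∀ {n} (t : Fin n → ℕ) i → (∀ j → j ≢ i → t j ≡ 0) → sum t ≡ t i
sum-supported-at {suc n} t i t≡0 = begin
  sum t                     ≡⟨ sum-remove t ⟩
  t i + sum (removeAt t i)  ≡⟨ cong (_+_ (t i)) (sum-cong-≗ (λ j → t≡0 (punchIn i j) (punchInᵢ≢i i j))) ⟩
  t i + ∑[ j < n ] 0        ≡⟨ cong (_+_ (t i)) (sum-replicate-zero n) ⟩
  t i + 0                   ≡⟨ +-identityʳ (t i) ⟩
  t i                       ∎
  where open ≡-Reasoning

module _ {a p} {A : Set a} {P : Pred A p} (P? : Decidable P) where

  length-filter-tabulate : ∀ {n} (f : Fin n → A) →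
    length (filter P? (tabulate f)) ≡ ∑[ i < n ] indicator (does (P? (f i)))
  length-filter-tabulate {zero}  f = refl
  length-filter-tabulate {suc n} f with does (P? (f Fin.zero))
  ... | true  = cong suc (length-filter-tabulate (f ∘ Fin.suc))
  ... | false = length-filter-tabulate (f ∘ Fin.suc)

module _ {a b p} {A : Set a} {B : Set b} {P : Pred (A × B) p} (P? : Decidable P) where

  length-filter-cartesianProduct : ∀ {m} (xs : Vector A m) (ys : List B) →
    length (filter P? (cartesianProduct (tabulate xs) ys)) ≡ ∑[ i < m ] length (filter P? (map (xs i ,_) ys))
  length-filter-cartesianProduct {zero}  xs ys = refl
  length-filter-cartesianProduct {suc m} xs ys = begin
    length (filter P? (row₀ ++ rest))                   ≡⟨ cong length (filter-++ P? row₀ rest) ⟩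
    length (filter P? row₀ ++ filter P? rest)           ≡⟨ length-++ (filter P? row₀) ⟩
    length (filter P? row₀) + length (filter P? rest)
      ≡⟨ cong (_+_ (length (filter P? row₀))) (length-filter-cartesianProduct (xs ∘ Fin.suc) ys) ⟩
    ∑[ i < suc m ] length (filter P? (map (xs i ,_) ys)) ∎
    where
    open ≡-Reasoning
    row₀ = map (xs Fin.zero ,_) ys
    rest = cartesianProduct (tabulate (xs ∘ Fin.suc)) ys

rowCount : ∀ {m n} → (V m n → Bool) → Fin n → ℕ
rowCount {m} S h = ∑[ g < m ] indicator (S (g , h))

x≡rowCount : ∀ {m n} .{{_ : NonZero n}} (S : V m n → Bool) z h → toℕ h ≡ z %ℕ n → x m n S z ≡ rowCount S h
x≡rowCount {m} {n} S z h h≡z = begin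
  x m n S z                                               ≡⟨ length-filter-cartesianProduct P? id (allFin n) ⟩
  ∑[ g < m ] length (filter P? (map (g ,_) (allFin n)))   ≡⟨ sum-cong-≗ row ⟩
  rowCount S h                                            ∎
  where
  open ≡-Reasoning
  P? = λ (v : V m n) → T? (S v) ×-dec (toℕ (proj₂ v) ℕ.≟ z %ℕ n)

  entry : Fin m → Fin n → ℕ
  entry g y = indicator (S (g , y) ∧ does (toℕ y ℕ.≟ z %ℕ n))

  entry-off-row : ∀ g y → y ≢ h → entry g y ≡ 0
  entry-off-row g y y≢h
    rewrite dec-false (toℕ y ℕ.≟ z %ℕ n) (λ y≡z → y≢h (toℕ-injective (trans y≡z (sym h≡z))))
    = cong indicator (∧-zeroʳ (S (g , y)))

  row : ∀ g → length (filter P? (map (g ,_) (allFin n))) ≡ indicator (S (g , h))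
  row g = begin
    length (filter P? (map (g ,_) (allFin n)))  ≡⟨ cong (length ∘ filter P?) (map-tabulate id (g ,_)) ⟩
    length (filter P? (tabulate (g ,_)))         ≡⟨ length-filter-tabulate P? (g ,_) ⟩
    sum (entry g)                                ≡⟨ sum-supported-at (entry g) h (entry-off-row g) ⟩
    entry g h                                    ≡⟨ cong (λ b → indicator (S (g , h) ∧ b)) (dec-true (toℕ h ℕ.≟ z %ℕ n) h≡z) ⟩
    indicator (S (g , h) ∧ true)                 ≡⟨ cong indicator (∧-identityʳ (S (g , h))) ⟩
    indicator (S (g , h))                        ∎

module Torus (k₁ k₂ : ℕ) where

  private
    m = suc k₁
    n = suc k₂

  module G = Rotation k₁
  module H = Rotation k₂

  -- A stencil position is a rotation of the first coordinate together with a target row, so that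
  -- as g runs through Fin m the position runs through a permutation of that row (sum-place).
  Offset : Set
  Offset = Permutation′ m × Fin n

  place : Offset → Fin m → V m n
  place (π , h) g = (π ⟨$⟩ʳ g , h)

  private
    ρ ρ⁻¹ : Permutation′ m
    ρ   = G.rotation
    ρ⁻¹ = flip G.rotation

  firstOffsets : Fin n → Vector Offset 4
  firstOffsets h = (Perm.id , H.next h) ∷ (Perm.id , H.prev h) ∷ (ρ , h) ∷ (ρ⁻¹ , h) ∷ []

  secondOffsets : Fin n → Vector Offset 8
  secondOffsets h = (ρ ∘ₚ ρ , h) ∷ (ρ⁻¹ ∘ₚ ρ⁻¹ , h)
                  ∷ (Perm.id , H.next (H.next h)) ∷ (Perm.id , H.prev (H.prev h))
                  ∷ (ρ , H.next h) ∷ (ρ , H.prev h) ∷ (ρ⁻¹ , H.next h) ∷ (ρ⁻¹ , H.prev h) ∷ []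

  neighbour : V m n → Fin 4 → V m n
  neighbour (g , h) i = place (firstOffsets h i) g

  secondNeighbour : V m n → Fin 8 → V m n
  secondNeighbour (g , h) l = place (secondOffsets h l) g

  adj⇒neighbour : ∀ {v u} → Adj m n v u → ∃[ i ] u ≡ neighbour v i
  adj⇒neighbour (inj₁ (refl , h~h′)) with H.cycleAdj⇒next⊎prev h~h′
  ... | inj₁ refl = 0F , refl
  ... | inj₂ refl = 1F , refl
  adj⇒neighbour (inj₂ (refl , g~g′)) with G.cycleAdj⇒next⊎prev g~g′
  ... | inj₁ refl = 2F , refl
  ... | inj₂ refl = 3F , refl

  neighbour-of-neighbour : ∀ v i j →
    neighbour (neighbour v i) j ≡ v ⊎ ∃[ l ] neighbour (neighbour v i) j ≡ secondNeighbour v l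
  neighbour-of-neighbour (g , h) 0F 0F = inj₂ (2F , refl)
  neighbour-of-neighbour (g , h) 0F 1F = inj₁ (cong (g ,_) (H.prev-next h))
  neighbour-of-neighbour (g , h) 0F 2F = inj₂ (4F , refl)
  neighbour-of-neighbour (g , h) 0F 3F = inj₂ (6F , refl)
  neighbour-of-neighbour (g , h) 1F 0F = inj₁ (cong (g ,_) (H.next-prev h))
  neighbour-of-neighbour (g , h) 1F 1F = inj₂ (3F , refl)
  neighbour-of-neighbour (g , h) 1F 2F = inj₂ (5F , refl)
  neighbour-of-neighbour (g , h) 1F 3F = inj₂ (7F , refl)
  neighbour-of-neighbour (g , h) 2F 0F = inj₂ (4F , refl)
  neighbour-of-neighbour (g , h) 2F 1F = inj₂ (5F , refl)
  neighbour-of-neighbour (g , h) 2F 2F = inj₂ (0F , refl)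
  neighbour-of-neighbour (g , h) 2F 3F = inj₁ (cong (_, h) (G.prev-next g))
  neighbour-of-neighbour (g , h) 3F 0F = inj₂ (6F , refl)
  neighbour-of-neighbour (g , h) 3F 1F = inj₂ (7F , refl)
  neighbour-of-neighbour (g , h) 3F 2F = inj₁ (cong (_, h) (G.next-prev g))
  neighbour-of-neighbour (g , h) 3F 3F = inj₂ (1F , refl)

  dist2⇒secondNeighbour : ∀ {v u} → Dist2 m n v u → ∃[ l ] u ≡ secondNeighbour v l
  dist2⇒secondNeighbour {v} {u} (v≢u , _ , w , v~w , w~u) = combine (adj⇒neighbour v~w) (adj⇒neighbour w~u)
    where
    combine : ∃[ i ] w ≡ neighbour v i → ∃[ j ] u ≡ neighbour w j → ∃[ l ] u ≡ secondNeighbour v l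
    combine (i , w≡vi) (j , u≡wj) = [ (λ vij≡v → ⊥-elim (v≢u (sym (trans u≡vij vij≡v))))
                                    , (λ (l , vij≡vl) → l , trans u≡vij vij≡vl) ]′ (neighbour-of-neighbour v i j)
      where
      u≡vij : u ≡ neighbour (neighbour v i) j
      u≡vij = trans u≡wj (cong (λ w → neighbour w j) w≡vi)

  module Weights (S : V m n → Bool) where

    a : V m n → ℕ
    a = indicator ∘ S

    X : Fin n → ℕ
    X = rowCount S

    neighbourCount secondNeighbourCount : V m n → ℕ
    neighbourCount v       = ∑[ i < 4 ] a (neighbour v i)
    secondNeighbourCount v = ∑[ l < 8 ] a (secondNeighbour v l)

    weight : V m n → ℕ
    weight v = 2 * a v + 2 * neighbourCount v + secondNeighbourCount v

    2≤weight : IsDisjunctiveDominating m n S → ∀ v → 2 ≤ weight v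
    2≤weight dom v with T? (S v)
    ... | yes v∈S = begin
      2 * 1                                ≡⟨ cong (2 *_) (T⇒indicator≡1 v∈S) ⟨
      2 * a v                              ≤⟨ m≤m+n (2 * a v) (2 * neighbourCount v) ⟩
      2 * a v + 2 * neighbourCount v       ≤⟨ m≤m+n _ (secondNeighbourCount v) ⟩
      weight v                             ∎
      where open ≤-Reasoning
    ... | no v∉S with dom v v∉S
    ...   | inj₁ (u , u∈S , v~u) = begin
      2 * 1                                ≡⟨ cong (2 *_) (trans (cong a (sym u≡vi)) (T⇒indicator≡1 u∈S)) ⟨
      2 * a (neighbour v i)                ≤⟨ *-monoʳ-≤ 2 (t[i]≤sum (a ∘ neighbour v) i) ⟩
      2 * neighbourCount v                 ≤⟨ m≤n+m (2 * neighbourCount v) (2 * a v) ⟩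
      2 * a v + 2 * neighbourCount v       ≤⟨ m≤m+n _ (secondNeighbourCount v) ⟩
      weight v                             ∎
      where
      open ≤-Reasoning
      i = proj₁ (adj⇒neighbour v~u)
      u≡vi = proj₂ (adj⇒neighbour v~u)
    ...   | inj₂ (u , w , u≢w , u∈S , w∈S , v~₂u , v~₂w) = begin
      1 + 1                                ≡⟨ cong₂ _+_ (trans (cong a (sym u≡vl)) (T⇒indicator≡1 u∈S))
                                                        (trans (cong a (sym w≡vl′)) (T⇒indicator≡1 w∈S)) ⟨
      a (secondNeighbour v l) + a (secondNeighbour v l′)
                                           ≤⟨ t[i]+t[j]≤sum (a ∘ secondNeighbour v) l≢l′ ⟩
      secondNeighbourCount v               ≤⟨ m≤n+m (secondNeighbourCount v) (2 * a v + 2 * neighbourCount v) ⟩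
      weight v                             ∎
      where
      open ≤-Reasoning
      l = proj₁ (dist2⇒secondNeighbour v~₂u)
      u≡vl = proj₂ (dist2⇒secondNeighbour v~₂u)
      l′ = proj₁ (dist2⇒secondNeighbour v~₂w)
      w≡vl′ = proj₂ (dist2⇒secondNeighbour v~₂w)
      l≢l′ : l ≢ l′
      l≢l′ l≡l′ = u≢w (trans u≡vl (trans (cong (secondNeighbour v) l≡l′) (sym w≡vl′)))

    sum-place : ∀ o → ∑[ g < m ] a (place o g) ≡ X (proj₂ o)
    sum-place (π , h) = sym (sum-permute (λ g → a (g , h)) π)

    sum-offsets : ∀ {l} (os : Vector Offset l) →
      ∑[ g < m ] ∑[ i < l ] a (place (os i) g) ≡ ∑[ i < l ] X (proj₂ (os i))
    sum-offsets os = trans (∑-comm (λ g i → a (place (os i) g))) (sum-cong-≗ (sum-place ∘ os))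

    sum-weight : ∀ h → ∑[ g < m ] weight (g , h) ≡
      X (H.prev (H.prev h)) + 4 * X (H.prev h) + 8 * X h + 4 * X (H.next h) + X (H.next (H.next h))
    sum-weight h = begin
      sum (λ g → 2 * A g + 2 * N₁ g + N₂ g)         ≡⟨ ∑-distrib-+ (λ g → 2 * A g + 2 * N₁ g) N₂ ⟩
      sum (λ g → 2 * A g + 2 * N₁ g) + sum N₂       ≡⟨ cong (_+ sum N₂) (∑-distrib-+ (λ g → 2 * A g) (λ g → 2 * N₁ g)) ⟩
      sum (λ g → 2 * A g) + sum (λ g → 2 * N₁ g) + sum N₂
        ≡⟨ cong₂ (λ s t → s + t + sum N₂) (*-distribˡ-sum 2 A) (*-distribˡ-sum 2 N₁) ⟨
      2 * X h + 2 * sum N₁ + sum N₂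
        ≡⟨ cong₂ (λ s t → 2 * X h + 2 * s + t) (sum-offsets (firstOffsets h)) (sum-offsets (secondOffsets h)) ⟩
      2 * X h + 2 * ∑[ i < 4 ] X (proj₂ (firstOffsets h i)) + ∑[ l < 8 ] X (proj₂ (secondOffsets h l))
        ≡⟨ collect (X (H.prev (H.prev h))) (X (H.prev h)) (X h) (X (H.next h)) (X (H.next (H.next h))) ⟩
      X (H.prev (H.prev h)) + 4 * X (H.prev h) + 8 * X h + 4 * X (H.next h) + X (H.next (H.next h)) ∎
      where
      open ≡-Reasoning
      A N₁ N₂ : Fin m → ℕ
      A g  = a (g , h)
      N₁ g = neighbourCount (g , h)
      N₂ g = secondNeighbourCount (g , h)
      collect : ∀ x₋₂ x₋₁ x₀ x₁ x₂ →
        2 * x₀ + 2 * (x₁ + (x₋₁ + (x₀ + (x₀ + 0)))) + (x₀ + (x₀ + (x₂ + (x₋₂ + (x₁ + (x₋₁ + (x₁ + (x₋₁ + 0))))))))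
          ≡ x₋₂ + 4 * x₋₁ + 8 * x₀ + 4 * x₁ + x₂
      collect = solve-∀

    stencil-bound : IsDisjunctiveDominating m n S → ∀ h →
      2 * m ≤ x m n S (+ toℕ h ℤ.- + 2) + 4 * x m n S (+ toℕ h ℤ.- + 1) + 8 * x m n S (+ toℕ h)
              + 4 * x m n S (+ toℕ h ℤ.+ + 1) + x m n S (+ toℕ h ℤ.+ + 2)
    stencil-bound dom h
      rewrite x≡rowCount S (+ toℕ h ℤ.- + 2) (H.prev (H.prev h)) (H.toℕ-prev²≡[i-2]%ℕ h)
            | x≡rowCount S (+ toℕ h ℤ.- + 1) (H.prev h) (H.toℕ-prev≡[i-1]%ℕ h)
            | x≡rowCount S (+ toℕ h) h (H.toℕ≡i%ℕ h)
            | x≡rowCount S (+ toℕ h ℤ.+ + 1) (H.next h) (H.toℕ-next≡[i+1]%ℕ h)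
            | x≡rowCount S (+ toℕ h ℤ.+ + 2) (H.next (H.next h)) (H.toℕ-next²≡[i+2]%ℕ h)
      = begin
      2 * m                       ≡⟨ *-comm 2 m ⟩
      m * 2                       ≡⟨ sum-const m 2 ⟨
      ∑[ _ < m ] 2                ≤⟨ sum-mono-≤ (λ g → 2≤weight dom (g , h)) ⟩
      sum (λ g → weight (g , h))  ≡⟨ sum-weight h ⟩
      X (H.prev (H.prev h)) + 4 * X (H.prev h) + 8 * X h + 4 * X (H.next h) + X (H.next (H.next h)) ∎
      where open ≤-Reasoning

lemma2p1 : (m n : ℕ) .{{_ : NonZero n}} → 3 ≤ m → 5 ≤ n →
    (S : V m n → Bool) → IsDisjunctiveDominating m n S →
    (j : ℕ) → j < n →
    2 * m ≤ x m n S (+ j ℤ.- + 2) + 4 * x m n S (+ j ℤ.- + 1) + 8 * x m n S (+ j)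
            + 4 * x m n S (+ j ℤ.+ + 1) + x m n S (+ j ℤ.+ + 2)
-- 3 ≤ m and 5 ≤ n only rule out empty cycles: the counting argument works for all m, n ≥ 1.
lemma2p1 zero    _       ()  _  _ _   _ _
lemma2p1 (suc _) zero    _   () _ _   _ _
lemma2p1 (suc k₁) (suc k₂) _ _ S dom j j<n with fromℕ< j<n | toℕ-fromℕ< j<n
... | h | refl = Torus.Weights.stencil-bound k₁ k₂ S dom h
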